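{- Let $G,H,H'$ be finite digraphs, $\xi\in\mathcal{H}(G,H)$, $\zeta\in\mathcal{H}(G,H')$, and let $v\in V(G)$ with $\Gamma_\xi(v)\subseteq\Gamma_\zeta(v)$. Then $\Gamma_\xi(v)\subsetneq\Gamma_\zeta(v)$ if and only if there are $a,b\in\Gamma_\zeta(v)$ such that $ab$ is a proper arc of $G$ and $\xi(a)\xi(b)$ is a proper arc of $H$.
   Context: A digraph $G=(V(G),A(G))$ has finite non-empty $V(G)$ and $A(G)\subseteq V(G)\times V(G)$; an arc $vw$ is proper if $v\ne w$. $\mathcal{H}(G,H)$ is the set of homomorphisms (maps $\xi:V(G)\to V(H)$ with $\xi(v)\xi(w)\in A(H)$ for all $vw\in A(G)$). $v,w$ are adjacent if $vw\in A(G)$ or $wv\in A(G)$. For $X\subseteq V(G)$, $v\in X$, $\gamma_X(v)$ is the set of $w\in X$ with $w=v$ or for which there are $v=z_0,\dots,z_I=w$ in $X$ with $z_{i-1},z_i$ adjacent; for a map $\xi$ on $V(G)$, $\Gamma_\xi(v)=\gamma_{\xi^{ -1}(\xi(v))}(v)$. -}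

module Defs where

open import Data.Nat using (ℕ; suc)
open import Data.Fin using (Fin)
open import Data.Bool using (Bool; true)
open import Data.Sum using (_⊎_)
open import Data.Product using (_×_)
open import Relation.Binary.PropositionalEquality using (_≡_; _≢_)
open import Relation.Nullary using (¬_)

-- A finite digraph: vertex set V(G) = Fin (suc n) (finite, non-empty),
-- arc set A(G) ⊆ V × V given by its (decidable) characteristic function.
record Digraph : Set where
  field
    n   : ℕ
    arc : Fin (suc n) → Fin (suc n) → Bool

open Digraph public

V : Digraph → Set
V G = Fin (suc (n G))

Arc : (G : Digraph) → V G → V G → Set
Arc G v w = arc G v w ≡ true

ProperArc : (G : Digraph) → V G → V G → Set
ProperArc G v w = Arc G v w × v ≢ w

IsHom : (G H : Digraph) → (V G → V H) → Set
IsHom G H ξ = ∀ v w → Arc G v w → Arc H (ξ v) (ξ w)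

Adjacent : (G : Digraph) → V G → V G → Set
Adjacent G v w = Arc G v w ⊎ Arc G w v

Subset : Digraph → Set₁
Subset G = V G → Set

data Walk (G : Digraph) (X : Subset G) : V G → V G → Set where
  here : ∀ {v} → X v → Walk G X v v
  step : ∀ {u v w} → X u → Adjacent G u v → Walk G X v w → Walk G X u w

γ : (G : Digraph) → (X : Subset G) → V G → Subset G
γ G X v w = X w × (w ≡ v ⊎ Walk G X v w)

Fibre : (G : Digraph) {B : Set} → (V G → B) → V G → Subset G
Fibre G ξ v w = ξ w ≡ ξ v

Γ : (G : Digraph) {B : Set} → (V G → B) → V G → Subset G
Γ G ξ v = γ G (Fibre G ξ v) v

_⊆_ : {A : Set} → (A → Set) → (A → Set) → Set
P ⊆ Q = ∀ x → P x → Q x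

-- proper inclusion: P ⊆ Q and P ≠ Q (as sets), i.e. not Q ⊆ P
_⊊_ : {A : Set} → (A → Set) → (A → Set) → Set
P ⊊ Q = P ⊆ Q × ¬ (Q ⊆ P)

{-# OPTIONS --safe #-}
-- If Γ_ζ(v) ⊄ Γ_ξ(v), some ζ-walk from v leaves the ξ-fibre of v; at the first step
-- where it does, the arc joining the two vertices is proper in G and, ξ being a
-- homomorphism, is mapped to a proper arc of H.  Conversely, a ξ-proper arc inside
-- Γ_ζ(v) has an endpoint outside the ξ-fibre of v.  Constructively, the forward
-- direction needs the existence of such an arc to be decidable, which rests on
-- deciding reachability in a finite graph by exploring it.
module Submission where

open import Defs
open import Data.Bool using (true)
import Data.Bool.Properties as Bool
open import Data.Empty using (⊥-elim)
open import Data.Fin.Properties using (any?; _≟_)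
open import Data.Fin.Subset renaming (Subset to FinSubset) using (_∈_; _∉_; _∪_; ⁅_⁆; _⊂_; _⊃_)
open import Data.Fin.Subset.Induction using (⊃-wellFounded)
open import Data.Fin.Subset.Properties using (_∈?_; p⊆p∪q; q⊆p∪q; x∈p∪q⁻; x∈⁅x⁆; x∈⁅y⁆⇒x≡y)
open import Data.Nat using (suc)
open import Data.Product using (Σ; ∃; _×_; _,_; proj₁)
open import Data.Sum using (_⊎_; inj₁; inj₂; [_,_])
open import Function.Bundles using (_⇔_; mk⇔)
open import Induction.WellFounded using (Acc; acc)
open import Relation.Binary.Definitions using (DecidableEquality)
open import Relation.Binary.PropositionalEquality using (_≡_; _≢_; refl; sym; trans; subst; cong)
open import Relation.Nullary using (Dec; yes; no; ¬_)
open import Relation.Nullary.Decidable using (_×-dec_; _⊎-dec_; ¬?)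

walk-source : ∀ {G X a b} → Walk G X a b → X a
walk-source (here xa)     = xa
walk-source (step xa _ _) = xa

walk-target : ∀ {G X a b} → Walk G X a b → X b
walk-target (here xb)    = xb
walk-target (step _ _ p) = walk-target p

walk-snoc : ∀ {G X a u w} → Walk G X a u → Adjacent G u w → X w → Walk G X a w
walk-snoc (here xa)       adj xw = step xa adj (here xw)
walk-snoc (step xa adj′ p) adj xw = step xa adj′ (walk-snoc p adj xw)

adjacent? : (G : Digraph) (a b : V G) → Dec (Adjacent G a b)
adjacent? G a b = (arc G a b Bool.≟ true) ⊎-dec (arc G b a Bool.≟ true)

properArc? : (G : Digraph) (a b : V G) → Dec (ProperArc G a b)
properArc? G a b = (arc G a b Bool.≟ true) ×-dec ¬? (a ≟ b)

-- Deciding whether a walk inside X leads from v to w, by growing a set of vertices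
-- reachable from v until no adjacency leaves it within X.
module Reachability (G : Digraph) (X : Subset G) (X? : ∀ w → Dec (X w)) (v : V G) where

  VertexSet : Set
  VertexSet = FinSubset (suc (n G))

  Reached : VertexSet → Set
  Reached S = ∀ x → x ∈ S → Walk G X v x

  Exit : VertexSet → Set
  Exit S = ∃ λ u → ∃ λ w → u ∈ S × w ∉ S × X w × Adjacent G u w

  exit? : ∀ S → Dec (Exit S)
  exit? S = any? λ u → any? λ w →
    (u ∈? S) ×-dec (¬? (w ∈? S) ×-dec (X? w ×-dec adjacent? G u w))

  walk-stays : ∀ S → ¬ Exit S → ∀ {u w} → u ∈ S → Walk G X u w → w ∈ S
  walk-stays S noExit u∈S (here _) = u∈S
  walk-stays S noExit {u} u∈S (step {v = u′} _ adj p) with u′ ∈? S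
  ... | yes u′∈S = walk-stays S noExit u′∈S p
  ... | no  u′∉S = ⊥-elim (noExit (u , u′ , u∈S , u′∉S , walk-source p , adj))

  explore : ∀ S → Acc _⊃_ S → Reached S → v ∈ S → ∀ w → Dec (Walk G X v w)
  explore S (acc smaller) reached v∈S w with exit? S
  ... | yes (u , u′ , u∈S , u′∉S , xu′ , adj) =
    explore S′ (smaller S⊂S′) reached′ (p⊆p∪q ⁅ u′ ⁆ v∈S) w
    where
    S′ : VertexSet
    S′ = S ∪ ⁅ u′ ⁆

    S⊂S′ : S ⊂ S′
    S⊂S′ = p⊆p∪q ⁅ u′ ⁆ , u′ , q⊆p∪q S ⁅ u′ ⁆ (x∈⁅x⁆ u′) , u′∉S

    reached′ : Reached S′
    reached′ x x∈S′ with x∈p∪q⁻ S ⁅ u′ ⁆ x∈S′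
    ... | inj₁ x∈S  = reached x x∈S
    ... | inj₂ x≡u′ = subst (Walk G X v) (sym (x∈⁅y⁆⇒x≡y u′ x≡u′))
                            (walk-snoc (reached u u∈S) adj xu′)
  ... | no noExit with w ∈? S
  ...   | yes w∈S = yes (reached w w∈S)
  ...   | no  w∉S = no λ p → w∉S (walk-stays S noExit v∈S p)

  walk? : ∀ w → Dec (Walk G X v w)
  walk? w with X? v
  ... | no  ¬xv = no λ p → ¬xv (walk-source p)
  ... | yes xv  = explore ⁅ v ⁆ (⊃-wellFounded _) reached-v (x∈⁅x⁆ v) w
    where
    reached-v : Reached ⁅ v ⁆
    reached-v x x≡v = subst (Walk G X v) (sym (x∈⁅y⁆⇒x≡y v x≡v)) (here xv)

Γ? : (G : Digraph) {B : Set} → DecidableEquality B → (ξ : V G → B) → ∀ v w → Dec (Γ G ξ v w)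
Γ? G _≟B_ ξ v w =
  (ξ w ≟B ξ v) ×-dec ((w ≟ v) ⊎-dec Reachability.walk? G (Fibre G ξ v) (λ x → ξ x ≟B ξ v) v w)

walk-restrict : ∀ {G} {X Y : Subset G} {v} →
  (∀ {a b} → Walk G Y v a → Walk G X v a → Adjacent G a b → Y b → X b) →
  X v → ∀ {w} → Walk G Y v w → Walk G X v w
walk-restrict {G} {X} {Y} {v} closed xv p = extend (here (walk-source p)) (here xv) p
  where
  extend : ∀ {u w} → Walk G Y v u → Walk G X v u → Walk G Y u w → Walk G X v w
  extend _  q (here _) = q
  extend pY q (step _ adj r) =
    let yb = walk-source r
    in extend (walk-snoc pY adj yb) (walk-snoc q adj (closed pY q adj yb)) r

adjacent-split : ∀ {G H} {ξ : V G → V H} → IsHom G H ξ → ∀ {a b} →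
  Adjacent G a b → ξ a ≢ ξ b →
  (ProperArc G a b × ProperArc H (ξ a) (ξ b)) ⊎ (ProperArc G b a × ProperArc H (ξ b) (ξ a))
adjacent-split {ξ = ξ} hom {a} {b} (inj₁ ab) ξa≢ξb =
  inj₁ ((ab , λ a≡b → ξa≢ξb (cong ξ a≡b)) , (hom a b ab , ξa≢ξb))
adjacent-split {ξ = ξ} hom {a} {b} (inj₂ ba) ξa≢ξb =
  inj₂ ((ba , λ b≡a → ξa≢ξb (cong ξ (sym b≡a))) , (hom b a ba , λ e → ξa≢ξb (sym e)))

SplitArc : (G H : Digraph) {B : Set} (ξ : V G → V H) (ζ : V G → B) (v : V G) → Set
SplitArc G H ξ ζ v = Σ (V G) λ a → Σ (V G) λ b →
  Γ G ζ v a × Γ G ζ v b × ProperArc G a b × ProperArc H (ξ a) (ξ b)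

splitArc? : (G H : Digraph) {B : Set} → DecidableEquality B →
  (ξ : V G → V H) (ζ : V G → B) (v : V G) → Dec (SplitArc G H ξ ζ v)
splitArc? G H _≟B_ ξ ζ v = any? λ a → any? λ b →
  Γ? G _≟B_ ζ v a ×-dec Γ? G _≟B_ ζ v b ×-dec properArc? G a b ×-dec properArc? H (ξ a) (ξ b)

Γ-⊉-of-splitArc : ∀ {G H B} {ξ : V G → V H} {ζ : V G → B} {v} →
  SplitArc G H ξ ζ v → ¬ (Γ G ζ v ⊆ Γ G ξ v)
Γ-⊉-of-splitArc (a , b , Γa , Γb , _ , (_ , ξa≢ξb)) Γζ⊆Γξ =
  ξa≢ξb (trans (proj₁ (Γζ⊆Γξ a Γa)) (sym (proj₁ (Γζ⊆Γξ b Γb))))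

Γ-⊆-of-¬splitArc : ∀ {G H B} {ξ : V G → V H} {ζ : V G → B} {v} → IsHom G H ξ →
  ¬ SplitArc G H ξ ζ v → Γ G ζ v ⊆ Γ G ξ v
Γ-⊆-of-¬splitArc {ξ = ξ} _ _ x (_ , inj₁ x≡v) = cong ξ x≡v , inj₁ x≡v
Γ-⊆-of-¬splitArc {G} {H} {ξ = ξ} {ζ} {v} homξ noSplit x (_ , inj₂ p) =
  walk-target p′ , inj₂ p′
  where
  stays : ∀ {a b} → Walk G (Fibre G ζ v) v a → Walk G (Fibre G ξ v) v a →
          Adjacent G a b → ζ b ≡ ζ v → ξ b ≡ ξ v
  stays {a} {b} pζ pξ adj ζb≡ζv with ξ b ≟ ξ v
  ... | yes ξb≡ξv = ξb≡ξv
  ... | no  ξb≢ξv =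
    ⊥-elim ([ (λ (ab , ξab) → noSplit (a , b , Γa , Γb , ab , ξab))
            , (λ (ba , ξba) → noSplit (b , a , Γb , Γa , ba , ξba)) ]
            (adjacent-split {H = H} homξ adj λ e → ξb≢ξv (trans (sym e) (walk-target pξ))))
    where
    Γa : Γ G ζ v a
    Γa = walk-target pζ , inj₂ pζ
    Γb : Γ G ζ v b
    Γb = ζb≡ζv , inj₂ (walk-snoc pζ adj ζb≡ζv)

  p′ : Walk G (Fibre G ξ v) v x
  p′ = walk-restrict stays refl p

lemma1 : (G H H' : Digraph) (ξ : V G → V H) (ζ : V G → V H') →
    IsHom G H ξ → IsHom G H' ζ → (v : V G) →
    Γ G ξ v ⊆ Γ G ζ v →
    (Γ G ξ v ⊊ Γ G ζ v) ⇔
      Σ (V G) (λ a → Σ (V G) (λ b →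
        Γ G ζ v a × Γ G ζ v b × ProperArc G a b × ProperArc H (ξ a) (ξ b)))
lemma1 G H H' ξ ζ homξ _ v Γξ⊆Γζ =
  mk⇔ split-arc λ s → Γξ⊆Γζ , Γ-⊉-of-splitArc {H = H} s
  where
  split-arc : Γ G ξ v ⊊ Γ G ζ v → SplitArc G H ξ ζ v
  split-arc (_ , Γζ⊈Γξ) with splitArc? G H _≟_ ξ ζ v
  ... | yes s       = s
  ... | no  noSplit = ⊥-elim (Γζ⊈Γξ (Γ-⊆-of-¬splitArc {H = H} homξ noSplit))
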